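{- Let $c$ be a configuration of the complete graph $K_n$ with $c(v)\le n-1$ for all vertices $v$. Then $c$ is volatile if and only if there is an ordering $v_1,v_2,\dots,v_n$ of $V(K_n)$ such that $c(v_i)\ge n-i$ for all $i\in\{1,\dots,n\}$.
   Context: A configuration of a graph $G$ is a function $c: V(G)\to \mathbb{N}\cup\{0\}$. A vertex $v$ may be fired if it currently has at least $\deg(v)$ chips; firing $v$ removes $\deg(v)$ chips from $v$ and adds one chip to each neighbour. A configuration is volatile if there is an infinite sequence of vertices that may be fired in that order. -}

module Defs where

open import Data.Nat using (ℕ; zero; suc; _+_; _∸_; _≤_)
open import Data.Bool using (Bool; true; false; if_then_else_; not)
open import Data.Fin using (Fin; toℕ; _≟_)
open import Data.List using (List; map; allFin)
open import Data.Nat.ListAction using (sum)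
open import Relation.Nullary.Decidable using (⌊_⌋)
open import Relation.Binary.PropositionalEquality using (_≡_)
open import Data.Product using (Σ; _×_)

Graph : ℕ → Set
Graph n = Fin n → Fin n → Bool

K : (n : ℕ) → Graph n
K n u v = not ⌊ u ≟ v ⌋

deg : {n : ℕ} → Graph n → Fin n → ℕ
deg {n} G v = sum (map (λ w → if G v w then 1 else 0) (allFin n))

Config : ℕ → Set
Config n = Fin n → ℕ

fire : {n : ℕ} → Graph n → Config n → Fin n → Config n
fire G c v w =
  if ⌊ w ≟ v ⌋ then c v ∸ deg G v
  else c w + (if G v w then 1 else 0)

after : {n : ℕ} → Graph n → Config n → (ℕ → Fin n) → ℕ → Config n
after G c s zero = c
after G c s (suc k) = fire G (after G c s k) (s k)

Volatile : {n : ℕ} → Graph n → Config n → Set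
Volatile G c = Σ (ℕ → Fin _) (λ s → (k : ℕ) → deg G (s k) ≤ after G c s k (s k))

-- On K_n = K (suc m) a firing moves every vertex by the same amount modulo n: the fired
-- vertex loses m chips, the others gain one.  Hence after k legal firings a vertex w that
-- has been fired f times holds exactly c w + k − n f chips.  While k ≤ m this forces every
-- vertex fired at step k to be fresh (a refired one would need c w + k ≥ m + n > 2m), so the
-- first n firings are a permutation σ with m ≤ c (σ k) + k.  Conversely, firing σ 0, …, σ m
-- in that order is legal by the same count and returns every vertex to c, so the round can
-- be repeated forever.
module Submission where

open import Defs
open import Data.Nat using (ℕ; zero; suc; _≤_; _<_; _∸_; _+_; _*_; s≤s⁻¹; _<?_; NonZero; >-nonZero⁻¹)
open import Data.Nat.Properties hiding (_≟_)
open import Data.Nat.DivMod using (_%_; _mod_; m%n<n; [m+n]%n≡m%n; m<n⇒m%n≡m)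
open import Data.Nat.Induction using (<-rec)
open import Data.Nat.ListAction using (sum)
open import Data.Fin using (Fin; toℕ; punchOut; _≟_)
open import Data.Fin.Properties using (toℕ-fromℕ<; toℕ-injective; toℕ<n; toℕ≤pred[n]; any?; punchOut-injective; injective⇒≤)
open import Data.Fin.Permutation using (Permutation′; _⟨$⟩ʳ_; _⟨$⟩ˡ_; permutation; inverseˡ; inverseʳ)
open import Data.Bool using (true; false; if_then_else_)
open import Data.List using (tabulate)
open import Data.List.Properties using (tabulate-cong; map-tabulate)
open import Data.Product using (Σ; ∃; _,_; proj₁; proj₂)
open import Data.Sum using (inj₁; inj₂)
open import Function using (id; _∘_)
open import Function.Bundles using (_⇔_; mk⇔)
open import Function.Definitions using (Injective)
open import Relation.Binary using (tri<; tri≈; tri>)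
open import Relation.Binary.PropositionalEquality
open import Relation.Nullary using (yes; no; contradiction)
open import Relation.Nullary.Decidable using (⌊_⌋)

injective⇒surjective : ∀ {n} {f : Fin n → Fin n} → Injective _≡_ _≡_ f → ∀ y → ∃ λ x → f x ≡ y
injective⇒surjective {suc n} {f} f-injective y with any? (λ x → f x ≟ y)
... | yes hit  = hit
... | no  miss = contradiction (injective⇒≤ g-injective) 1+n≰n
  where
  g : Fin (suc n) → Fin n
  g x = punchOut (λ y≡fx → miss (x , sym y≡fx))
  g-injective : Injective _≡_ _≡_ g
  g-injective gx≡gy = f-injective (punchOut-injective {i = y} _ _ gx≡gy)

injective⇒permutation : ∀ {n} {f : Fin n → Fin n} → Injective _≡_ _≡_ f →
                        ∃ λ (π : Permutation′ n) → ∀ i → π ⟨$⟩ʳ i ≡ f i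
injective⇒permutation {f = f} f-injective =
  permutation f (proj₁ ∘ surjective) (proj₂ ∘ surjective) (λ x → f-injective (proj₂ (surjective (f x)))) ,
  λ _ → refl
  where
  surjective = injective⇒surjective f-injective

m≤n⇒n+[1+m]*o≤m+m⇒o≡0 : ∀ {m n} o → m ≤ n → n + suc m * o ≤ m + m → o ≡ 0
m≤n⇒n+[1+m]*o≤m+m⇒o≡0             zero    _   _     = refl
m≤n⇒n+[1+m]*o≤m+m⇒o≡0 {m} {n} (suc o) m≤n bound = contradiction (≤-trans too-big bound) 1+n≰n
  where
  too-big : suc (m + m) ≤ n + suc m * suc o
  too-big = subst (_≤ n + suc m * suc o) (+-suc m m) (+-mono-≤ m≤n (m≤m*n (suc m) (suc o)))

toℕ-mod : ∀ {n} .{{_ : NonZero n}} {r} → r < n → toℕ (r mod n) ≡ r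
toℕ-mod {n} {r} r<n = trans (toℕ-fromℕ< (m%n<n r n)) (m<n⇒m%n≡m r<n)

[n+k]modn≡kmodn : ∀ n .{{_ : NonZero n}} k → (n + k) mod n ≡ k mod n
[n+k]modn≡kmodn n k = toℕ-injective (begin
  toℕ ((n + k) mod n)  ≡⟨ toℕ-fromℕ< (m%n<n (n + k) n) ⟩
  (n + k) % n          ≡⟨ cong (_% n) (+-comm n k) ⟩
  (k + n) % n          ≡⟨ [m+n]%n≡m%n k n ⟩
  k % n                ≡⟨ toℕ-fromℕ< (m%n<n k n) ⟨
  toℕ (k mod n)        ∎)
  where open ≡-Reasoning

Legal : {n : ℕ} → Graph n → Config n → (ℕ → Fin n) → ℕ → Set
Legal G c s k = deg G (s k) ≤ after G c s k (s k)

fire-cong : ∀ {n} (G : Graph n) {c d : Config n} → (∀ w → c w ≡ d w) →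
            ∀ v w → fire G c v w ≡ fire G d v w
fire-cong G c≗d v w with ⌊ w ≟ v ⌋
... | true  = cong (_∸ deg G v) (c≗d v)
... | false = cong (_+ (if G v w then 1 else 0)) (c≗d w)

after-periodic : ∀ {n} (G : Graph n) (c : Config n) (s : ℕ → Fin n) (p : ℕ) →
                 (∀ k → s (p + k) ≡ s k) → (∀ w → after G c s p w ≡ c w) →
                 ∀ k w → after G c s (p + k) w ≡ after G c s k w
after-periodic G c s p s-periodic returns zero w =
  trans (cong (λ k → after G c s k w) (+-identityʳ p)) (returns w)
after-periodic G c s p s-periodic returns (suc k) w = begin
  after G c s (p + suc k) w                          ≡⟨ cong (λ j → after G c s j w) (+-suc p k) ⟩
  fire G (after G c s (p + k)) (s (p + k)) w         ≡⟨ cong (λ v → fire G (after G c s (p + k)) v w) (s-periodic k) ⟩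
  fire G (after G c s (p + k)) (s k) w               ≡⟨ fire-cong G (after-periodic G c s p s-periodic returns k) (s k) w ⟩
  after G c s (suc k) w                              ∎
  where open ≡-Reasoning

periodic-volatile : ∀ {n} (G : Graph n) (c : Config n) (s : ℕ → Fin n) (p : ℕ) .{{_ : NonZero p}} →
                    (∀ k → s (p + k) ≡ s k) → (∀ w → after G c s p w ≡ c w) →
                    (∀ k → k < p → Legal G c s k) → Volatile G c
periodic-volatile G c s p s-periodic returns legal-period = s , <-rec (Legal G c s) legal
  where
  legal : ∀ k → (∀ {j} → j < k → Legal G c s j) → Legal G c s k
  legal k rec with k <? p
  ... | yes k<p = legal-period k k<p
  ... | no k≮p = subst (Legal G c s) (m+[n∸m]≡n p≤k) legal-shifted
    where
    p≤k : p ≤ k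
    p≤k = ≮⇒≥ k≮p
    legal-shifted : Legal G c s (p + (k ∸ p))
    legal-shifted rewrite s-periodic (k ∸ p)
                        | after-periodic G c s p s-periodic returns (k ∸ p) (s (k ∸ p))
                        = rec (∸-monoʳ-< (>-nonZero⁻¹ p) p≤k)

K-adjacent : ∀ {n} {u w : Fin n} → u ≢ w → K n u w ≡ true
K-adjacent {u = u} {w} u≢w with u ≟ w
... | yes u≡w = contradiction u≡w u≢w
... | no _    = refl

K-suc : ∀ {n} (u w : Fin n) → K (suc n) (Fin.suc u) (Fin.suc w) ≡ K n u w
K-suc u w with u ≟ w
... | yes _ = refl
... | no _  = refl

sum-tabulate-1 : ∀ n → sum (tabulate {n = n} (λ _ → 1)) ≡ n
sum-tabulate-1 zero    = refl
sum-tabulate-1 (suc n) = cong suc (sum-tabulate-1 n)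

sum-tabulate-K : ∀ {n} (v : Fin n) → sum (tabulate (λ w → if K n v w then 1 else 0)) ≡ n ∸ 1
sum-tabulate-K {suc n}       Fin.zero    = sum-tabulate-1 n
sum-tabulate-K {suc (suc n)} (Fin.suc v) = cong suc (begin
  sum (tabulate (λ w → if K (suc (suc n)) (Fin.suc v) (Fin.suc w) then 1 else 0))
    ≡⟨ cong sum (tabulate-cong (λ w → cong (λ b → if b then 1 else 0) (K-suc v w))) ⟩
  sum (tabulate (λ w → if K (suc n) v w then 1 else 0))
    ≡⟨ sum-tabulate-K v ⟩
  suc n ∸ 1 ∎)
  where open ≡-Reasoning

deg-K : ∀ {n} (v : Fin n) → deg (K n) v ≡ n ∸ 1
deg-K {n} v = trans (cong sum (map-tabulate id (λ w → if K n v w then 1 else 0))) (sum-tabulate-K v)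

δ : ∀ {n} → Fin n → Fin n → ℕ
δ w v = if ⌊ w ≟ v ⌋ then 1 else 0

δ-refl : ∀ {n} (w : Fin n) → δ w w ≡ 1
δ-refl w with w ≟ w
... | yes _   = refl
... | no w≢w = contradiction refl w≢w

≢⇒δ≡0 : ∀ {n} {w v : Fin n} → w ≢ v → δ w v ≡ 0
≢⇒δ≡0 {w = w} {v} w≢v with w ≟ v
... | yes w≡v = contradiction w≡v w≢v
... | no _    = refl

δ≡0⇒≢ : ∀ {n} {w v : Fin n} → δ w v ≡ 0 → w ≢ v
δ≡0⇒≢ {w = w} δ≡0 refl = 1+n≢0 (trans (sym (δ-refl w)) δ≡0)

firings : ∀ {n} → (ℕ → Fin n) → Fin n → ℕ → ℕ
firings s w zero    = 0
firings s w (suc k) = δ w (s k) + firings s w k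

firings≡0⇒≢ : ∀ {n} (s : ℕ → Fin n) {w k i} → firings s w k ≡ 0 → i < k → s i ≢ w
firings≡0⇒≢ s {w} {suc k} {i} zero-firings i<1+k with m≤n⇒m<n∨m≡n (s≤s⁻¹ i<1+k)
... | inj₁ i<k  = firings≡0⇒≢ s (m+n≡0⇒n≡0 (δ w (s k)) zero-firings) i<k
... | inj₂ refl = δ≡0⇒≢ (m+n≡0⇒m≡0 (δ w (s i)) zero-firings) ∘ sym

≢⇒firings≡0 : ∀ {n} (s : ℕ → Fin n) {w} k → (∀ {i} → i < k → s i ≢ w) → firings s w k ≡ 0
≢⇒firings≡0 s zero    never = refl
≢⇒firings≡0 s (suc k) never =
  cong₂ _+_ (≢⇒δ≡0 (never (n<1+n k) ∘ sym)) (≢⇒firings≡0 s k (never ∘ m<n⇒m<1+n))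

unique⇒firings≡1 : ∀ {n} (s : ℕ → Fin n) {w j} k → j < k → s j ≡ w →
                   (∀ {i} → i < k → s i ≡ w → i ≡ j) → firings s w k ≡ 1
unique⇒firings≡1 s {w} {j} (suc k) j<1+k sj≡w unique with m≤n⇒m<n∨m≡n (s≤s⁻¹ j<1+k)
... | inj₁ j<k  = cong₂ _+_ (≢⇒δ≡0 (λ w≡sk → <-irrefl (sym (unique (n<1+n k) (sym w≡sk))) j<k))
                            (unique⇒firings≡1 s k j<k sj≡w (unique ∘ m<n⇒m<1+n))
... | inj₂ refl = cong₂ _+_ (trans (cong (δ w) sj≡w) (δ-refl w))
                            (≢⇒firings≡0 s k (λ i<j si≡w → <-irrefl (unique (m<n⇒m<1+n i<j) si≡w) i<j))

fire-K : ∀ {m} (c : Config (suc m)) {v} → m ≤ c v → ∀ w →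
         fire (K (suc m)) c v w + suc m * δ w v ≡ c w + 1
fire-K {m} c {v} m≤cv w with w ≟ v
... | yes refl = begin
  c w ∸ deg (K (suc m)) w + suc m * 1  ≡⟨ cong₂ _+_ (cong (c w ∸_) (deg-K w)) (*-identityʳ (suc m)) ⟩
  c w ∸ m + suc m                      ≡⟨ +-suc (c w ∸ m) m ⟩
  suc (c w ∸ m + m)                    ≡⟨ cong suc (m∸n+n≡m m≤cv) ⟩
  suc (c w)                            ≡⟨ +-comm 1 (c w) ⟩
  c w + 1                              ∎
  where open ≡-Reasoning
... | no w≢v rewrite K-adjacent (w≢v ∘ sym) | *-zeroʳ (suc m) = +-identityʳ (c w + 1)

Legal-K⁻ : ∀ {m} {c : Config (suc m)} {s} {k} → Legal (K (suc m)) c s k → m ≤ after (K (suc m)) c s k (s k)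
Legal-K⁻ {m} {c} {s} {k} = subst (_≤ after (K (suc m)) c s k (s k)) (deg-K (s k))

Legal-K⁺ : ∀ {m} {c : Config (suc m)} {s} {k} → m ≤ after (K (suc m)) c s k (s k) → Legal (K (suc m)) c s k
Legal-K⁺ {m} {c} {s} {k} = subst (_≤ after (K (suc m)) c s k (s k)) (sym (deg-K (s k)))

chips-after : ∀ {m} (c : Config (suc m)) (s : ℕ → Fin (suc m)) k →
              (∀ {i} → i < k → Legal (K (suc m)) c s i) →
              ∀ w → after (K (suc m)) c s k w + suc m * firings s w k ≡ c w + k
chips-after {m} c s zero    legal w = cong (c w +_) (*-zeroʳ (suc m))
chips-after {m} c s (suc k) legal w = begin
  fire (K n) A (s k) w + n * (δ w (s k) + f)     ≡⟨ cong (fire (K n) A (s k) w +_) (*-distribˡ-+ n (δ w (s k)) f) ⟩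
  fire (K n) A (s k) w + (n * δ w (s k) + n * f) ≡⟨ +-assoc (fire (K n) A (s k) w) _ _ ⟨
  fire (K n) A (s k) w + n * δ w (s k) + n * f   ≡⟨ cong (_+ n * f) (fire-K A legal-k w) ⟩
  A w + 1 + n * f                                ≡⟨ +-assoc (A w) 1 (n * f) ⟩
  A w + (1 + n * f)                              ≡⟨ cong (A w +_) (+-comm 1 (n * f)) ⟩
  A w + (n * f + 1)                              ≡⟨ +-assoc (A w) (n * f) 1 ⟨
  A w + n * f + 1                                ≡⟨ cong (_+ 1) (chips-after c s k (legal ∘ m<n⇒m<1+n) w) ⟩
  c w + k + 1                                    ≡⟨ +-assoc (c w) k 1 ⟩
  c w + (k + 1)                                  ≡⟨ cong (c w +_) (+-comm k 1) ⟩
  c w + suc k                                    ∎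
  where
  open ≡-Reasoning
  n = suc m
  A = after (K n) c s k
  f = firings s w k
  legal-k : m ≤ A (s k)
  legal-k = Legal-K⁻ {c = c} {s} {k} (legal (n<1+n k))

unfired-chips : ∀ {m} (c : Config (suc m)) (s : ℕ → Fin (suc m)) k →
                (∀ {i} → i < k → Legal (K (suc m)) c s i) →
                ∀ {w} → firings s w k ≡ 0 → after (K (suc m)) c s k w ≡ c w + k
unfired-chips {m} c s k legal {w} unfired = begin
  A                          ≡⟨ +-identityʳ A ⟨
  A + 0                      ≡⟨ cong (A +_) (*-zeroʳ (suc m)) ⟨
  A + suc m * 0              ≡⟨ cong (λ f → A + suc m * f) unfired ⟨
  A + suc m * firings s w k  ≡⟨ chips-after c s k legal w ⟩
  c w + k                    ∎
  where
  open ≡-Reasoning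
  A = after (K (suc m)) c s k w

once-fired-chips : ∀ {m} (c : Config (suc m)) (s : ℕ → Fin (suc m)) k →
                   (∀ {i} → i < k → Legal (K (suc m)) c s i) →
                   ∀ {w} → firings s w k ≡ 1 → after (K (suc m)) c s k w + suc m ≡ c w + k
once-fired-chips {m} c s k legal {w} once = begin
  A + suc m                  ≡⟨ cong (A +_) (*-identityʳ (suc m)) ⟨
  A + suc m * 1              ≡⟨ cong (λ f → A + suc m * f) once ⟨
  A + suc m * firings s w k  ≡⟨ chips-after c s k legal w ⟩
  c w + k                    ∎
  where
  open ≡-Reasoning
  A = after (K (suc m)) c s k w

module _ {m} {c : Config (suc m)} {s : ℕ → Fin (suc m)}
         (legal : ∀ k → Legal (K (suc m)) c s k) (c≤m : ∀ v → c v ≤ m) where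

  fresh-in-first-round : ∀ {k} → k ≤ m → firings s (s k) k ≡ 0
  fresh-in-first-round {k} k≤m =
    m≤n⇒n+[1+m]*o≤m+m⇒o≡0 (firings s (s k) k) (Legal-K⁻ {c = c} {s} {k} (legal k)) (begin
      after (K (suc m)) c s k (s k) + suc m * firings s (s k) k  ≡⟨ chips-after c s k (λ {i} _ → legal i) (s k) ⟩
      c (s k) + k                                                ≤⟨ +-mono-≤ (c≤m (s k)) k≤m ⟩
      m + m                                                      ∎)
    where open ≤-Reasoning

  threshold-in-first-round : ∀ {k} → k ≤ m → m ∸ k ≤ c (s k)
  threshold-in-first-round {k} k≤m = m≤n+o⇒m∸n≤o m k (begin
    m                              ≤⟨ Legal-K⁻ {c = c} {s} {k} (legal k) ⟩
    after (K (suc m)) c s k (s k)  ≡⟨ unfired-chips c s k (λ {i} _ → legal i) (fresh-in-first-round k≤m) ⟩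
    c (s k) + k                    ≡⟨ +-comm (c (s k)) k ⟩
    k + c (s k)                    ∎)
    where open ≤-Reasoning

  first-round-injective : Injective _≡_ _≡_ (λ (i : Fin (suc m)) → s (toℕ i))
  first-round-injective {i} {j} si≡sj with <-cmp (toℕ i) (toℕ j)
  ... | tri< i<j _ _ = contradiction si≡sj (firings≡0⇒≢ s (fresh-in-first-round (toℕ≤pred[n] j)) i<j)
  ... | tri≈ _ i≡j _ = toℕ-injective i≡j
  ... | tri> _ _ j<i = contradiction (sym si≡sj) (firings≡0⇒≢ s (fresh-in-first-round (toℕ≤pred[n] i)) j<i)

module _ {m} {c : Config (suc m)} (σ : Permutation′ (suc m))
         (threshold : ∀ i → m ∸ toℕ i ≤ c (σ ⟨$⟩ʳ i)) where

  round : ℕ → Fin (suc m)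
  round k = σ ⟨$⟩ʳ (k mod suc m)

  round-periodic : ∀ k → round (suc m + k) ≡ round k
  round-periodic k = cong (σ ⟨$⟩ʳ_) ([n+k]modn≡kmodn (suc m) k)

  round-injective : ∀ {i j} → i < suc m → j < suc m → round i ≡ round j → i ≡ j
  round-injective {i} {j} i<n j<n round-i≡round-j = begin
    i                                  ≡⟨ toℕ-mod i<n ⟨
    toℕ (i mod suc m)                  ≡⟨ cong toℕ (inverseˡ σ) ⟨
    toℕ (σ ⟨$⟩ˡ round i)               ≡⟨ cong (λ v → toℕ (σ ⟨$⟩ˡ v)) round-i≡round-j ⟩
    toℕ (σ ⟨$⟩ˡ round j)               ≡⟨ cong toℕ (inverseˡ σ) ⟩
    toℕ (j mod suc m)                  ≡⟨ toℕ-mod j<n ⟩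
    j                                  ∎
    where open ≡-Reasoning

  round-hits : ∀ w → round (toℕ (σ ⟨$⟩ˡ w)) ≡ w
  round-hits w = trans (cong (σ ⟨$⟩ʳ_) (toℕ-injective (toℕ-mod (toℕ<n (σ ⟨$⟩ˡ w))))) (inverseʳ σ)

  round-fresh : ∀ {r} → r < suc m → firings round (round r) r ≡ 0
  round-fresh {r} r<n = ≢⇒firings≡0 round r (λ i<r same → <-irrefl (round-injective (<-trans i<r r<n) r<n same) i<r)

  round-legal : ∀ r → r < suc m → Legal (K (suc m)) c round r
  round-legal = <-rec (λ r → r < suc m → Legal (K (suc m)) c round r) λ r rec r<n →
    Legal-K⁺ {c = c} {round} {r} (begin
      m                                   ≤⟨ m≤n+m∸n m r ⟩
      r + (m ∸ r)                         ≡⟨ cong (λ i → r + (m ∸ i)) (toℕ-mod r<n) ⟨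
      r + (m ∸ toℕ (r mod suc m))         ≤⟨ +-monoʳ-≤ r (threshold (r mod suc m)) ⟩
      r + c (round r)                     ≡⟨ +-comm r (c (round r)) ⟩
      c (round r) + r                     ≡⟨ unfired-chips c round r (λ i<r → rec i<r (<-trans i<r r<n))
                                               (round-fresh r<n) ⟨
      after (K (suc m)) c round r (round r) ∎)
    where open ≤-Reasoning

  round-returns : ∀ w → after (K (suc m)) c round (suc m) w ≡ c w
  round-returns w = +-cancelʳ-≡ (suc m) _ (c w) (once-fired-chips c round (suc m) (λ i<n → round-legal _ i<n)
    (unique⇒firings≡1 round (suc m) (toℕ<n (σ ⟨$⟩ˡ w)) (round-hits w)
      (λ i<n round-i≡w → round-injective i<n (toℕ<n (σ ⟨$⟩ˡ w)) (trans round-i≡w (sym (round-hits w))))))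

  round-volatile : Volatile (K (suc m)) c
  round-volatile = periodic-volatile (K (suc m)) c round (suc m) round-periodic round-returns round-legal

theorem2p3 : (n : ℕ) → 1 ≤ n → (c : Config n) → ((v : Fin n) → c v ≤ n ∸ 1) →
    (Volatile (K n) c ⇔ Σ (Permutation′ n) (λ σ → (i : Fin n) → n ∸ suc (toℕ i) ≤ c (σ ⟨$⟩ʳ i)))
theorem2p3 (suc m) _ c c≤m = mk⇔ volatile⇒ordering ordering⇒volatile
  where
  Ordering : Permutation′ (suc m) → Set
  Ordering σ = ∀ i → m ∸ toℕ i ≤ c (σ ⟨$⟩ʳ i)

  volatile⇒ordering : Volatile (K (suc m)) c → Σ (Permutation′ (suc m)) Ordering
  volatile⇒ordering (s , legal) with σ , σ≗s ← injective⇒permutation (first-round-injective legal c≤m) =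
    σ , λ i → subst (λ v → m ∸ toℕ i ≤ c v) (sym (σ≗s i))
                    (threshold-in-first-round legal c≤m (toℕ≤pred[n] i))

  ordering⇒volatile : Σ (Permutation′ (suc m)) Ordering → Volatile (K (suc m)) c
  ordering⇒volatile (σ , threshold) = round-volatile σ threshold
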